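{- Every arrow of $\mathrm{Spr}(\mathbf{Rel}_f^{\mathcal{M}})$ is equal to an expression built from the ten arrows $\Delta, \bot, \nabla, \top, \Lambda, \downarrow, \mathsf{V}, \uparrow, \mathsf{I}, \mathsf{X}$ (defined below) using only composition $;$ and tensor $\otimes$.
   Context: For a set $X$, $\mathcal{M}(X)$ is the set of finitely supported functions $X\to\mathbb{N}$ (multisets); an ordinary subset is regarded as a multiset with multiplicities $0/1$. For $h : A \to \mathcal{M}(X)$, $h^\#(\mathcal{U}) = \sum_{a\in A}\mathcal{U}(a)\,h(a)$. $\mathbf{Rel}_f^{\mathcal{M}}$ has objects finite sets, arrows $A \nrightarrow X$ the functions $A \to \mathcal{M}(X)$, identity $a\mapsto\{a\}$ and composition $k\circ h = k^\#\circ h$. A multi $(f,g)$-synchronisation for $f : A\nrightarrow X$, $g : B \nrightarrow X$ is a pair $(\mathcal{U},\mathcal{V})\in\mathcal{M}(A)\times\mathcal{M}(B)$ with $f^\#(\mathcal{U}) = g^\#(\mathcal{V})$, ordered pointwise; it is minimal if nonzero and every synchronisation below it is $(0,0)$ or equal to it. $\mathrm{Spr}(\mathbf{Rel}_f^{\mathcal{M}})$ has objects natural numbers $k$ (identified with $\{0,\dots,k-1\}$) and arrows $k\to l$ the isomorphism classes of spans $k \xleftarrow{a} x \xrightarrow{b} l$ in $\mathbf{Rel}_f^{\mathcal{M}}$, $x$ finite, with $y \mapsto (a(y),b(y))$ injective $x \to \mathcal{M}(k)\times\mathcal{M}(l)$. Composition $;$ (diagrammatic order) of $k_0 \xleftarrow{f_0}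 x_0 \xrightarrow{g_0} k_1$ and $k_1 \xleftarrow{f_1} x_1 \xrightarrow{g_1} k_2$: take the set $S$ of minimal $(g_0,f_1)$-synchronisations, map $\sigma = (\mathcal{U},\mathcal{V}) \mapsto (f_0^\#(\mathcal{U}), g_1^\#(\mathcal{V})) \in \mathcal{M}(k_0)\times\mathcal{M}(k_2)$, and take as composite the image of this map with the two projections as legs. The tensor $\otimes$ takes disjoint unions of boundaries and carriers, with legs acting componentwise and $k_1+k_2$ identified with the ordinal $k_1+k_2$. Writing a span as (carrier; left leg; right leg): $\Delta : 1 \to 2$ is ($\{0\}$; $0\mapsto\{0\}$; $0\mapsto\{0,1\}$); $\bot : 1\to 0$ is ($\{0\}$; $0\mapsto\{0\}$; $0 \mapsto \varnothing$); $\nabla : 2\to 1$ is ($\{0\}$; $0\mapsto\{0,1\}$; $0\mapsto\{0\}$); $\top : 0 \to 1$ is ($\{0\}$; $0\mapsto\varnothing$; $0\mapsto\{0\}$); $\Lambda : 1\to 2$ is ($\{0,1\}$; $i\mapsto\{0\}$; $i\mapsto\{i\}$); $\downarrow : 1 \to 0$ has empty carrier; $\mathsf{V} : 2 \to 1$ is ($\{0,1\}$; $i\mapsto\{i\}$; $i\mapsto\{0\}$); $\uparrow : 0\to 1$ has empty carrier; $\mathsf{I} : 1\to 1$ is ($\{0\}$; $0\mapsto\{0\}$; $0\mapsto\{0\}$); $\mathsf{X} : 2\to 2$ is ($\{0,1\}$; $i\mapsto\{i\}$; $i\mapsto\{1-i\}$). -}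

module Defs where

open import Data.Nat using (ℕ; zero; suc; _+_; _*_; _≤_)
open import Data.Fin using (Fin; zero; suc; splitAt; _≟_)
open import Data.Sum using (_⊎_; inj₁; inj₂; [_,_])
open import Data.Product using (_×_; _,_; Σ-syntax; ∃-syntax)
open import Data.Bool using (if_then_else_)
open import Relation.Nullary using (¬_; does)
open import Relation.Binary.PropositionalEquality using (_≡_)

-- Multisets over the finite set Fin k : functions Fin k → ℕ
-- (automatically finitely supported).

Mset : ℕ → Set
Mset k = Fin k → ℕ

_≈ₘ_ : ∀ {k} → Mset k → Mset k → Set
U ≈ₘ V = ∀ i → U i ≡ V i

_≤ₘ_ : ∀ {k} → Mset k → Mset k → Set
U ≤ₘ V = ∀ i → U i ≤ V i

∅ₘ : ∀ {k} → Mset k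
∅ₘ _ = 0

⟦_⟧ₘ : ∀ {k} → Fin k → Mset k
⟦ i ⟧ₘ j = if does (i ≟ j) then 1 else 0

∑ : ∀ {n} → (Fin n → ℕ) → ℕ
∑ {zero}  f = 0
∑ {suc n} f = f zero + ∑ (λ i → f (suc i))

_♯ : ∀ {a x} → (Fin a → Mset x) → Mset a → Mset x
(h ♯) U y = ∑ (λ i → U i * h i y)

record Span (k l : ℕ) : Set where
  constructor span
  field
    carrier : ℕ
    left    : Fin carrier → Mset k
    right   : Fin carrier → Mset l
open Span public

InjectiveSpan : ∀ {k l} → Span k l → Set
InjectiveSpan s = ∀ y y' → left s y ≈ₘ left s y' → right s y ≈ₘ right s y' → y ≡ y'

record _≅_ {k l} (s t : Span k l) : Set where
  field
    to       : Fin (carrier s) → Fin (carrier t)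
    from     : Fin (carrier t) → Fin (carrier s)
    from-to  : ∀ y → from (to y) ≡ y
    to-from  : ∀ y → to (from y) ≡ y
    left-to  : ∀ y → left t (to y) ≈ₘ left s y
    right-to : ∀ y → right t (to y) ≈ₘ right s y

IsSync : ∀ {a b x} → (Fin a → Mset x) → (Fin b → Mset x) → Mset a → Mset b → Set
IsSync f g U V = (f ♯) U ≈ₘ (g ♯) V

IsMinimalSync : ∀ {a b x} → (Fin a → Mset x) → (Fin b → Mset x) → Mset a → Mset b → Set
IsMinimalSync {a} {b} f g U V =
  IsSync f g U V
  × ¬ (U ≈ₘ ∅ₘ × V ≈ₘ ∅ₘ)
  × (∀ (U' : Mset a) (V' : Mset b) → IsSync f g U' V' → U' ≤ₘ U → V' ≤ₘ V →
       (U' ≈ₘ ∅ₘ × V' ≈ₘ ∅ₘ) ⊎ (U' ≈ₘ U × V' ≈ₘ V))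

-- c is (a representative of) the composite s₀ ; s₁ : c is injective and its
-- set of leg-pairs is exactly the image of the minimal syncs.
IsComposite : ∀ {k₀ k₁ k₂} → Span k₀ k₁ → Span k₁ k₂ → Span k₀ k₂ → Set
IsComposite s₀ s₁ c =
  InjectiveSpan c
  × (∀ y → ∃[ U ] ∃[ V ] IsMinimalSync (right s₀) (left s₁) U V
            × (left c y ≈ₘ (left s₀ ♯) U) × (right c y ≈ₘ (right s₁ ♯) V))
  × (∀ U V → IsMinimalSync (right s₀) (left s₁) U V →
       ∃[ y ] (left c y ≈ₘ (left s₀ ♯) U) × (right c y ≈ₘ (right s₁ ♯) V))

_⊕ₘ_ : ∀ {k₁ k₂} → Mset k₁ → Mset k₂ → Mset (k₁ + k₂)
_⊕ₘ_ {k₁} U V = [ U , V ] ∘' splitAt k₁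
  where
  _∘'_ : ∀ {A B : Set} {C : Set} → (B → C) → (A → B) → A → C
  (g ∘' f) x = g (f x)

_⊗ₛ_ : ∀ {k₁ l₁ k₂ l₂} → Span k₁ l₁ → Span k₂ l₂ → Span (k₁ + k₂) (l₁ + l₂)
s ⊗ₛ t = span (carrier s + carrier t)
  (λ y → [ (λ y₁ → left s y₁ ⊕ₘ ∅ₘ) , (λ y₂ → ∅ₘ ⊕ₘ left t y₂) ] (splitAt (carrier s) y))
  (λ y → [ (λ y₁ → right s y₁ ⊕ₘ ∅ₘ) , (λ y₂ → ∅ₘ ⊕ₘ right t y₂) ] (splitAt (carrier s) y))

all₂ : Mset 2
all₂ _ = 1

flip₂ : Fin 2 → Fin 2
flip₂ zero = suc zero
flip₂ (suc _) = zero

ΔS : Span 1 2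
ΔS = span 1 (λ _ → ⟦ zero ⟧ₘ) (λ _ → all₂)

⊥S : Span 1 0
⊥S = span 1 (λ _ → ⟦ zero ⟧ₘ) (λ _ → ∅ₘ)

∇S : Span 2 1
∇S = span 1 (λ _ → all₂) (λ _ → ⟦ zero ⟧ₘ)

⊤S : Span 0 1
⊤S = span 1 (λ _ → ∅ₘ) (λ _ → ⟦ zero ⟧ₘ)

ΛS : Span 1 2
ΛS = span 2 (λ _ → ⟦ zero ⟧ₘ) (λ i → ⟦ i ⟧ₘ)

↓S : Span 1 0
↓S = span 0 (λ ()) (λ ())

VS : Span 2 1
VS = span 2 (λ i → ⟦ i ⟧ₘ) (λ _ → ⟦ zero ⟧ₘ)

↑S : Span 0 1
↑S = span 0 (λ ()) (λ ())

IS : Span 1 1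
IS = span 1 (λ _ → ⟦ zero ⟧ₘ) (λ _ → ⟦ zero ⟧ₘ)

XS : Span 2 2
XS = span 2 (λ i → ⟦ i ⟧ₘ) (λ i → ⟦ flip₂ i ⟧ₘ)

data Expr : ℕ → ℕ → Set where
  `Δ `Λ : Expr 1 2
  `⊥ `↓ : Expr 1 0
  `∇ `V : Expr 2 1
  `⊤ `↑ : Expr 0 1
  `I    : Expr 1 1
  `X    : Expr 2 2
  _⨾_   : ∀ {k l m} → Expr k l → Expr l m → Expr k m
  _⊗_   : ∀ {k₁ l₁ k₂ l₂} → Expr k₁ l₁ → Expr k₂ l₂ → Expr (k₁ + k₂) (l₁ + l₂)

data _⇓_ : ∀ {k l} → Expr k l → Span k l → Set where
  ⇓Δ : `Δ ⇓ ΔS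
  ⇓⊥ : `⊥ ⇓ ⊥S
  ⇓∇ : `∇ ⇓ ∇S
  ⇓⊤ : `⊤ ⇓ ⊤S
  ⇓Λ : `Λ ⇓ ΛS
  ⇓↓ : `↓ ⇓ ↓S
  ⇓V : `V ⇓ VS
  ⇓↑ : `↑ ⇓ ↑S
  ⇓I : `I ⇓ IS
  ⇓X : `X ⇓ XS
  ⇓⨾ : ∀ {k l m} {e₁ : Expr k l} {e₂ : Expr l m} {s₀ s₁ c} →
       e₁ ⇓ s₀ → e₂ ⇓ s₁ → IsComposite s₀ s₁ c → (e₁ ⨾ e₂) ⇓ c
  ⇓⊗ : ∀ {k₁ l₁ k₂ l₂} {e₁ : Expr k₁ l₁} {e₂ : Expr k₂ l₂} {s₁ s₂} →
       e₁ ⇓ s₁ → e₂ ⇓ s₂ → (e₁ ⊗ e₂) ⇓ (s₁ ⊗ₛ s₂)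

module Submission where

-- Call a span k ← n → n whose right leg is the identity y ↦ {y} the graph of
-- its left leg a : Fin n → Mset k.  The key fact (composite-after-graph) is
-- that composing a graph with any span s₁ is easy: the minimal syncs are
-- exactly the pairs (left s₁ x , {x}), so the composite is, up to the
-- choice of representative, the span with legs (a ♯ (left s₁ x), right s₁ x).
-- Hence graphs denoted by expressions ("realisable" maps) are closed under
-- composition, and (after some index bookkeeping) under tensor.  From the
-- generators we then realise, in turn: every function between finite sets,
-- every multiset on a one-point carrier, and finally every map
-- a : Fin n → Mset k.  Transposition (swapping the legs of spans) maps
-- denotations of expressions to denotations of expressions, so the graph of
-- b can be read backwards.  A span (a , b) is then the composite of the
-- graph of a with the transposed graph of b.

open import Defs
open import Data.Nat using (ℕ)
open import Data.Product using (_×_; ∃-syntax)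

open import Data.Nat using (zero; suc; _+_; _*_; _≤_; z≤n; s≤s) renaming (_≟_ to _≟ℕ_)
open import Data.Nat.Properties
  using (+-identityʳ; *-identityˡ; *-identityʳ; *-comm; +-assoc; ≤-trans; ≤-reflexive;
         m≤m+n; m≤n+m; 1+n≢0; *-monoˡ-≤; n≢0⇒n>0; n≤0⇒n≡0)
open import Data.Fin using (Fin; zero; suc; splitAt; join; _↑ˡ_; _↑ʳ_; _≟_)
open import Data.Fin.Properties using (splitAt-↑ˡ; splitAt-↑ʳ; join-splitAt; ¬∀⟶∃¬)
open import Data.Sum using (_⊎_; inj₁; inj₂; [_,_])
open import Data.Product using (_,_)
open import Data.Empty using (⊥-elim)
open import Relation.Nullary using (yes; no)
open import Relation.Binary.PropositionalEquality hiding ([_])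

≈ₘ-sym : ∀ {k} {U V : Mset k} → U ≈ₘ V → V ≈ₘ U
≈ₘ-sym p i = sym (p i)

≈ₘ-trans : ∀ {k} {U V W : Mset k} → U ≈ₘ V → V ≈ₘ W → U ≈ₘ W
≈ₘ-trans p q i = trans (p i) (q i)

∑-cong : ∀ {n} {f g : Fin n → ℕ} → (∀ i → f i ≡ g i) → ∑ f ≡ ∑ g
∑-cong {zero}  eq = refl
∑-cong {suc n} eq = cong₂ _+_ (eq zero) (∑-cong (λ i → eq (suc i)))

∑-zeros : ∀ n → ∑ {n} (λ _ → 0) ≡ 0
∑-zeros zero    = refl
∑-zeros (suc n) = ∑-zeros n

∑-≥ : ∀ {n} (f : Fin n → ℕ) x → f x ≤ ∑ f
∑-≥ f zero    = m≤m+n _ _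
∑-≥ f (suc x) = ≤-trans (∑-≥ (λ i → f (suc i)) x) (m≤n+m _ _)

∑-split : ∀ m {n} (f : Fin (m + n) → ℕ) →
  ∑ f ≡ ∑ (λ i → f (i ↑ˡ n)) + ∑ (λ i → f (m ↑ʳ i))
∑-split zero    f = refl
∑-split (suc m) f =
  trans (cong (f zero +_) (∑-split m (λ i → f (suc i)))) (sym (+-assoc (f zero) _ _))

δ-self : ∀ {n} (i : Fin n) → ⟦ i ⟧ₘ i ≡ 1
δ-self i with i ≟ i
... | yes _ = refl
... | no ¬p = ⊥-elim (¬p refl)

δ-other : ∀ {n} {i j : Fin n} → i ≢ j → ⟦ i ⟧ₘ j ≡ 0
δ-other {i = i} {j} i≢j with i ≟ j
... | yes p = ⊥-elim (i≢j p)
... | no _  = refl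

δ-sym : ∀ {n} (i j : Fin n) → ⟦ i ⟧ₘ j ≡ ⟦ j ⟧ₘ i
δ-sym zero    zero    = refl
δ-sym zero    (suc j) = refl
δ-sym (suc i) zero    = refl
δ-sym (suc i) (suc j) = δ-sym i j

δ-injective : ∀ {n} {i j : Fin n} → ⟦ i ⟧ₘ ≈ₘ ⟦ j ⟧ₘ → i ≡ j
δ-injective {i = zero}  {zero}  e = refl
δ-injective {i = zero}  {suc j} e with e zero
... | ()
δ-injective {i = suc i} {zero}  e with e zero
... | ()
δ-injective {i = suc i} {suc j} e = cong suc (δ-injective (λ x → e (suc x)))

∑-δ : ∀ {n} (z : Fin n) (f : Fin n → ℕ) → ∑ (λ i → ⟦ z ⟧ₘ i * f i) ≡ f z
∑-δ {suc n} zero    f =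
  trans (cong₂ _+_ (+-identityʳ (f zero)) (∑-zeros n)) (+-identityʳ (f zero))
∑-δ {suc n} (suc z) f = ∑-δ z (λ i → f (suc i))

agree-at : ∀ {n} {U W : Mset n} x → U x ≡ W x →
  (∀ i → x ≢ i → U i ≡ 0) → (∀ i → x ≢ i → W i ≡ 0) → U ≈ₘ W
agree-at x Ux≡Wx U0 W0 i with x ≟ i
... | yes refl = Ux≡Wx
... | no x≢i   = trans (U0 i x≢i) (sym (W0 i x≢i))

below-δ-vanishes : ∀ {n} {V : Mset n} x → V ≤ₘ ⟦ x ⟧ₘ → ∀ i → x ≢ i → V i ≡ 0
below-δ-vanishes x V≤δ i x≢i = n≤0⇒n≡0 (≤-trans (V≤δ i) (≤-reflexive (δ-other x≢i)))

δ-below : ∀ {n} {V : Mset n} x → V ≤ₘ ⟦ x ⟧ₘ → V ≈ₘ ∅ₘ ⊎ V ≈ₘ ⟦ x ⟧ₘ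
δ-below {V = V} x V≤δ with V x in Vx | V≤δ x
... | zero     | _ = inj₁ (agree-at x Vx (below-δ-vanishes x V≤δ) (λ _ _ → refl))
... | suc zero | _ =
  inj₂ (agree-at x (trans Vx (sym (δ-self x))) (below-δ-vanishes x V≤δ) (λ _ → δ-other))
... | suc (suc _) | 2≤δx with ≤-trans 2≤δx (≤-reflexive (δ-self x))
...   | s≤s ()

♯-congˡ : ∀ {a x} {h h' : Fin a → Mset x} → (∀ i → h i ≈ₘ h' i) → ∀ U → (h ♯) U ≈ₘ (h' ♯) U
♯-congˡ h≈h' U y = ∑-cong (λ i → cong (U i *_) (h≈h' i y))

♯-congʳ : ∀ {a x} (h : Fin a → Mset x) {U U' : Mset a} → U ≈ₘ U' → (h ♯) U ≈ₘ (h ♯) U'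
♯-congʳ h U≈U' y = ∑-cong (λ i → cong (_* h i y) (U≈U' i))

♯-δ : ∀ {a x} (h : Fin a → Mset x) (z : Fin a) → (h ♯) ⟦ z ⟧ₘ ≈ₘ h z
♯-δ h z y = ∑-δ z (λ i → h i y)

♯-unit : ∀ {a} (U : Mset a) → ((λ i → ⟦ i ⟧ₘ) ♯) U ≈ₘ U
♯-unit U y = begin
  ∑ (λ i → U i * ⟦ i ⟧ₘ y)  ≡⟨ ∑-cong (λ i → trans (*-comm (U i) _) (cong (_* U i) (δ-sym i y))) ⟩
  ∑ (λ i → ⟦ y ⟧ₘ i * U i)  ≡⟨ ∑-δ y U ⟩
  U y                       ∎
  where open ≡-Reasoning

♯-∅ : ∀ {a x} (h : Fin a → Mset x) → (h ♯) ∅ₘ ≈ₘ ∅ₘ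
♯-∅ {a} h y = ∑-zeros a

♯-≥ : ∀ {a x} (h : Fin a → Mset x) (V : Mset a) z → 1 ≤ V z → h z ≤ₘ (h ♯) V
♯-≥ h V z 1≤Vz y =
  ≤-trans (≤-trans (≤-reflexive (sym (*-identityˡ (h z y)))) (*-monoˡ-≤ (h z y) 1≤Vz))
          (∑-≥ (λ i → V i * h i y) z)

module GraphComposite {k m l} (l₀ : Fin m → Mset k) {r₀ : Fin m → Mset m}
                      (r₀≈δ : ∀ y → r₀ y ≈ₘ ⟦ y ⟧ₘ) (s₁ : Span m l) where

  g : Fin (carrier s₁) → Mset m
  g = left s₁

  -- Since r₀ ♯ is the identity, a sync is a pair (g ♯ V , V).
  sync→ : ∀ U V → IsSync r₀ g U V → U ≈ₘ (g ♯) V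
  sync→ U V s = ≈ₘ-trans (≈ₘ-sym (≈ₘ-trans (♯-congˡ r₀≈δ U) (♯-unit U))) s

  →sync : ∀ U V → U ≈ₘ (g ♯) V → IsSync r₀ g U V
  →sync U V e = ≈ₘ-trans (≈ₘ-trans (♯-congˡ r₀≈δ U) (♯-unit U)) e

  point-sync : ∀ x → IsSync r₀ g (g x) ⟦ x ⟧ₘ
  point-sync x = →sync (g x) ⟦ x ⟧ₘ (≈ₘ-sym (♯-δ g x))

  point-minimal : ∀ x → IsMinimalSync r₀ g (g x) ⟦ x ⟧ₘ
  point-minimal x = point-sync x , (λ (_ , δ≈∅) → 1+n≢0 (trans (sym (δ-self x)) (δ≈∅ x))) , below
    where
    below : ∀ U' V' → IsSync r₀ g U' V' → U' ≤ₘ g x → V' ≤ₘ ⟦ x ⟧ₘ →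
            (U' ≈ₘ ∅ₘ × V' ≈ₘ ∅ₘ) ⊎ (U' ≈ₘ g x × V' ≈ₘ ⟦ x ⟧ₘ)
    below U' V' s _ V'≤δ with δ-below x V'≤δ
    ... | inj₁ V'≈∅ = inj₁ (≈ₘ-trans (sync→ U' V' s) (≈ₘ-trans (♯-congʳ g V'≈∅) (♯-∅ g)) , V'≈∅)
    ... | inj₂ V'≈δ = inj₂ (≈ₘ-trans (sync→ U' V' s) (≈ₘ-trans (♯-congʳ g V'≈δ) (♯-δ g x)) , V'≈δ)

  -- Conversely, a minimal sync contains some point sync, hence equals it.
  minimal-is-point : ∀ {U V} → IsMinimalSync r₀ g U V → ∃[ x ] (U ≈ₘ g x × V ≈ₘ ⟦ x ⟧ₘ)
  minimal-is-point {U} {V} (s , nonzero , minimal)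
    with ¬∀⟶∃¬ _ (λ i → V i ≡ 0) (λ i → V i ≟ℕ 0)
               (λ V≈∅ → nonzero (≈ₘ-trans (sync→ U V s) (≈ₘ-trans (♯-congʳ g V≈∅) (♯-∅ g)) , V≈∅))
  ... | x , Vx≢0 with minimal (g x) ⟦ x ⟧ₘ (point-sync x) gx≤U δ≤V
    where
    gx≤U : g x ≤ₘ U
    gx≤U y = ≤-trans (♯-≥ g V x (n≢0⇒n>0 Vx≢0) y) (≤-reflexive (sym (sync→ U V s y)))
    δ≤V : ⟦ x ⟧ₘ ≤ₘ V
    δ≤V i with x ≟ i
    ... | yes refl = n≢0⇒n>0 Vx≢0
    ... | no _     = z≤n
  ... | inj₁ (_ , δ≈∅)    = ⊥-elim (1+n≢0 (trans (sym (δ-self x)) (δ≈∅ x)))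
  ... | inj₂ (gx≈U , δ≈V) = x , ≈ₘ-sym gx≈U , ≈ₘ-sym δ≈V

  composite-after-graph : (c : Span k l) → InjectiveSpan c →
    (∀ y → ∃[ x ] (left c y ≈ₘ (l₀ ♯) (g x) × right c y ≈ₘ right s₁ x)) →
    (∀ x → ∃[ y ] (left c y ≈ₘ (l₀ ♯) (g x) × right c y ≈ₘ right s₁ x)) →
    IsComposite (span m l₀ r₀) s₁ c
  composite-after-graph c inj c⊆ ⊆c = inj , covered , attained
    where
    covered : ∀ y → ∃[ U ] ∃[ V ] IsMinimalSync r₀ g U V
              × (left c y ≈ₘ (l₀ ♯) U) × (right c y ≈ₘ (right s₁ ♯) V)
    covered y with c⊆ y
    ... | x , l≈ , r≈ = g x , ⟦ x ⟧ₘ , point-minimal x , l≈ , ≈ₘ-trans r≈ (≈ₘ-sym (♯-δ (right s₁) x))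
    attained : ∀ U V → IsMinimalSync r₀ g U V →
               ∃[ y ] (left c y ≈ₘ (l₀ ♯) U) × (right c y ≈ₘ (right s₁ ♯) V)
    attained U V min with minimal-is-point min
    ... | x , U≈ , V≈ with ⊆c x
    ... | y , l≈ , r≈ =
      y , ≈ₘ-trans l≈ (♯-congʳ l₀ (≈ₘ-sym U≈))
        , ≈ₘ-trans r≈ (≈ₘ-trans (≈ₘ-sym (♯-δ (right s₁) x)) (♯-congʳ (right s₁) (≈ₘ-sym V≈)))

composite-after-graph′ : ∀ {k m l} {l₀ : Fin m → Mset k} {r₀ : Fin m → Mset m} →
  (∀ y → r₀ y ≈ₘ ⟦ y ⟧ₘ) → (s₁ : Span m l) →
  {L : Fin (carrier s₁) → Mset k} {R : Fin (carrier s₁) → Mset l} →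
  InjectiveSpan (span (carrier s₁) L R) →
  (∀ x → L x ≈ₘ (l₀ ♯) (left s₁ x)) → (∀ x → R x ≈ₘ right s₁ x) →
  IsComposite (span m l₀ r₀) s₁ (span (carrier s₁) L R)
composite-after-graph′ {l₀ = l₀} r₀≈δ s₁ inj L≈ R≈ =
  GraphComposite.composite-after-graph l₀ r₀≈δ s₁ _ inj
    (λ x → x , L≈ x , R≈ x) (λ x → x , L≈ x , R≈ x)

⊕-cong : ∀ {k₁ k₂} {U U' : Mset k₁} {V V' : Mset k₂} →
  U ≈ₘ U' → V ≈ₘ V' → (U ⊕ₘ V) ≈ₘ (U' ⊕ₘ V')
⊕-cong {k₁} U≈U' V≈V' j with splitAt k₁ j
... | inj₁ i = U≈U' i
... | inj₂ i = V≈V' i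

δ-↑ˡ : ∀ {m} n (i j : Fin m) → ⟦ i ↑ˡ n ⟧ₘ (j ↑ˡ n) ≡ ⟦ i ⟧ₘ j
δ-↑ˡ n zero    zero    = refl
δ-↑ˡ n zero    (suc j) = refl
δ-↑ˡ n (suc i) zero    = refl
δ-↑ˡ n (suc i) (suc j) = δ-↑ˡ n i j

δ-↑ʳ : ∀ m {n} (i j : Fin n) → ⟦ m ↑ʳ i ⟧ₘ (m ↑ʳ j) ≡ ⟦ i ⟧ₘ j
δ-↑ʳ zero    i j = refl
δ-↑ʳ (suc m) i j = δ-↑ʳ m i j

δ-↑ˡ-↑ʳ : ∀ {m} n (i : Fin m) (j : Fin n) → ⟦ i ↑ˡ n ⟧ₘ (m ↑ʳ j) ≡ 0
δ-↑ˡ-↑ʳ {suc m} n zero    j = refl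
δ-↑ˡ-↑ʳ {suc m} n (suc i) j = δ-↑ˡ-↑ʳ n i j

δ-⊕ˡ : ∀ {m} n (i : Fin m) → (⟦ i ⟧ₘ ⊕ₘ ∅ₘ {n}) ≈ₘ ⟦ i ↑ˡ n ⟧ₘ
δ-⊕ˡ {m} n i j = trans (halves (splitAt m j)) (cong ⟦ i ↑ˡ n ⟧ₘ (join-splitAt m n j))
  where
  halves : ∀ s → [ ⟦ i ⟧ₘ , ∅ₘ ] s ≡ ⟦ i ↑ˡ n ⟧ₘ (join m n s)
  halves (inj₁ j₁) = sym (δ-↑ˡ n i j₁)
  halves (inj₂ j₂) = sym (δ-↑ˡ-↑ʳ n i j₂)

δ-⊕ʳ : ∀ m {n} (i : Fin n) → (∅ₘ {m} ⊕ₘ ⟦ i ⟧ₘ) ≈ₘ ⟦ m ↑ʳ i ⟧ₘ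
δ-⊕ʳ m {n} i j = trans (halves (splitAt m j)) (cong ⟦ m ↑ʳ i ⟧ₘ (join-splitAt m n j))
  where
  halves : ∀ s → [ ∅ₘ , ⟦ i ⟧ₘ ] s ≡ ⟦ m ↑ʳ i ⟧ₘ (join m n s)
  halves (inj₁ j₁) = sym (trans (δ-sym (m ↑ʳ i) (j₁ ↑ˡ n)) (δ-↑ˡ-↑ʳ n j₁ i))
  halves (inj₂ j₂) = sym (δ-↑ʳ m i j₂)

tens : ∀ {k₁ k₂ n₁ n₂} → (Fin n₁ → Mset k₁) → (Fin n₂ → Mset k₂) →
  Fin (n₁ + n₂) → Mset (k₁ + k₂)
tens {n₁ = n₁} a₁ a₂ y = [ (λ y₁ → a₁ y₁ ⊕ₘ ∅ₘ) , (λ y₂ → ∅ₘ ⊕ₘ a₂ y₂) ] (splitAt n₁ y)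

tens-cong : ∀ {k₁ k₂ n₁ n₂} {a₁ a₁' : Fin n₁ → Mset k₁} {a₂ a₂' : Fin n₂ → Mset k₂} →
  (∀ y → a₁ y ≈ₘ a₁' y) → (∀ y → a₂ y ≈ₘ a₂' y) → ∀ y → tens a₁ a₂ y ≈ₘ tens a₁' a₂' y
tens-cong {n₁ = n₁} a₁≈ a₂≈ y with splitAt n₁ y
... | inj₁ y₁ = ⊕-cong (a₁≈ y₁) (λ _ → refl)
... | inj₂ y₂ = ⊕-cong (λ _ → refl) (a₂≈ y₂)

_⊕f_ : ∀ {m₁ m₂ k₁ k₂} → (Fin m₁ → Fin k₁) → (Fin m₂ → Fin k₂) → Fin (m₁ + m₂) → Fin (k₁ + k₂)
_⊕f_ {m₁} {k₂ = k₂} π₁ π₂ y = [ (λ y₁ → π₁ y₁ ↑ˡ k₂) , (λ y₂ → _ ↑ʳ π₂ y₂) ] (splitAt m₁ y)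

⊕f-id : ∀ m {n} (y : Fin (m + n)) → (_⊕f_ {m} {n} (λ i → i) (λ i → i)) y ≡ y
⊕f-id m {n} y = join-splitAt m n y

tens-δ : ∀ {m₁ m₂ k₁ k₂} (π₁ : Fin m₁ → Fin k₁) (π₂ : Fin m₂ → Fin k₂) y →
  tens (λ y₁ → ⟦ π₁ y₁ ⟧ₘ) (λ y₂ → ⟦ π₂ y₂ ⟧ₘ) y ≈ₘ ⟦ (π₁ ⊕f π₂) y ⟧ₘ
tens-δ {m₁} {k₁ = k₁} {k₂} π₁ π₂ y with splitAt m₁ y
... | inj₁ y₁ = δ-⊕ˡ k₂ (π₁ y₁)
... | inj₂ y₂ = δ-⊕ʳ k₁ (π₂ y₂)

tens-unit : ∀ n₁ {n₂} (y : Fin (n₁ + n₂)) →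
  tens {n₁ = n₁} {n₂} (λ i → ⟦ i ⟧ₘ) (λ i → ⟦ i ⟧ₘ) y ≈ₘ ⟦ y ⟧ₘ
tens-unit n₁ {n₂} y =
  ≈ₘ-trans (tens-δ {n₁} {n₂} (λ i → i) (λ i → i) y) (λ j → cong (λ z → ⟦ z ⟧ₘ j) (⊕f-id n₁ y))

record Realisable {k n} (a : Fin n → Mset k) : Set where
  constructor realised
  field
    {lft}   : Fin n → Mset k
    {rgt}   : Fin n → Mset n
    expr    : Expr k n
    denotes : expr ⇓ span n lft rgt
    lft≈    : ∀ y → lft y ≈ₘ a y
    rgt≈    : ∀ y → rgt y ≈ₘ ⟦ y ⟧ₘ
open Realisable

-- A function π between finite sets, seen as the map y ↦ ⟦ π y ⟧ₘ.  (A record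
-- rather than an abbreviation, so that π can be inferred from the type.)
record RealisableFn {k m} (π : Fin m → Fin k) : Set where
  constructor asFn
  field graph : Realisable (λ y → ⟦ π y ⟧ₘ)
open RealisableFn

congR : ∀ {k n} {a b : Fin n → Mset k} → Realisable a → (∀ y → a y ≈ₘ b y) → Realisable b
congR (realised e d l≈ r≈) a≈b = realised e d (λ y → ≈ₘ-trans (l≈ y) (a≈b y)) r≈

congFn : ∀ {k m} {π π' : Fin m → Fin k} → RealisableFn π → (∀ y → π y ≡ π' y) → RealisableFn π'
congFn (asFn R) π≡π' = asFn (congR R (λ y j → cong (λ z → ⟦ z ⟧ₘ j) (π≡π' y)))

_⨾R_ : ∀ {k m n} {f : Fin m → Mset k} {g : Fin n → Mset m} →
  Realisable f → Realisable g → Realisable (λ y → (f ♯) (g y))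
_⨾R_ {f = f} (realised {l₁} e₁ d₁ l₁≈ r₁≈) (realised {l₂} {r₂} e₂ d₂ l₂≈ r₂≈) =
  realised (e₁ ⨾ e₂) (⇓⨾ d₁ d₂ composite) (λ y → ≈ₘ-trans (♯-congˡ l₁≈ (l₂ y)) (♯-congʳ f (l₂≈ y)))
           (λ _ _ → refl)
  where
  composite : IsComposite (span _ l₁ _) (span _ l₂ r₂) (span _ (λ y → (l₁ ♯) (l₂ y)) (λ y → ⟦ y ⟧ₘ))
  composite = composite-after-graph′ r₁≈ (span _ l₂ r₂) (λ y y' _ δ≈ → δ-injective δ≈)
                (λ _ _ → refl) (λ y → ≈ₘ-sym (r₂≈ y))

_⊗R_ : ∀ {k₁ k₂ n₁ n₂} {a₁ : Fin n₁ → Mset k₁} {a₂ : Fin n₂ → Mset k₂} →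
  Realisable a₁ → Realisable a₂ → Realisable (tens a₁ a₂)
_⊗R_ {n₁ = n₁} (realised e₁ d₁ l₁≈ r₁≈) (realised e₂ d₂ l₂≈ r₂≈) =
  realised (e₁ ⊗ e₂) (⇓⊗ d₁ d₂) (tens-cong l₁≈ l₂≈)
    (λ y → ≈ₘ-trans (tens-cong r₁≈ r₂≈ y) (tens-unit n₁ y))

_⊗Fn_ : ∀ {k₁ k₂ m₁ m₂} {π₁ : Fin m₁ → Fin k₁} {π₂ : Fin m₂ → Fin k₂} →
  RealisableFn π₁ → RealisableFn π₂ → RealisableFn (π₁ ⊕f π₂)
_⊗Fn_ {π₁ = π₁} {π₂} (asFn F₁) (asFn F₂) = asFn (congR (F₁ ⊗R F₂) (tens-δ π₁ π₂))

_⨾F_ : ∀ {k m n} {π : Fin m → Fin k} {ρ : Fin n → Fin m} →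
  RealisableFn π → RealisableFn ρ → RealisableFn (λ y → π (ρ y))
_⨾F_ {π = π} {ρ} (asFn F) (asFn G) = asFn (congR (F ⨾R G) (λ y → ♯-δ (λ i → ⟦ π i ⟧ₘ) (ρ y)))

I-Fn : RealisableFn {1} {1} (λ y → y)
I-Fn = asFn (realised `I ⇓I (λ { zero _ → refl }) (λ { zero _ → refl }))

Λ-Fn : RealisableFn {1} {2} (λ _ → zero)
Λ-Fn = asFn (realised `Λ ⇓Λ (λ _ _ → refl) (λ _ _ → refl))

↓-R : Realisable {1} {0} (λ ())
↓-R = realised `↓ ⇓↓ (λ ()) (λ ())

⊤-R : Realisable {0} {1} (λ _ → ∅ₘ)
⊤-R = realised `⊤ ⇓⊤ (λ _ ()) (λ { zero _ → refl })

∇-R : Realisable {2} {1} (λ _ → all₂)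
∇-R = realised `∇ ⇓∇ (λ _ _ → refl) (λ { zero _ → refl })

transpose : ∀ {k l} → Span k l → Span l k
transpose s = span (carrier s) (right s) (left s)

-- The transpose of X is (up to relabelling its carrier) X itself, and it is
-- the graph of flip₂; it is denoted by composing the identity graph I ⊗ I with X.
X-transposed : ((`I ⊗ `I) ⨾ `X) ⇓ transpose XS
X-transposed = ⇓⨾ (⇓⊗ ⇓I ⇓I) ⇓X
  (GraphComposite.composite-after-graph (left (IS ⊗ₛ IS)) II≈δ XS (transpose XS)
     (λ _ _ _ δ≈ → δ-injective δ≈) (λ y → flip₂ y , matched y) unflip)
  where
  II≈δ : ∀ y → right (IS ⊗ₛ IS) y ≈ₘ ⟦ y ⟧ₘ
  II≈δ y = ≈ₘ-trans (tens-cong (rgt≈ (graph I-Fn)) (rgt≈ (graph I-Fn)) y) (tens-unit 1 y)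
  Matched : Fin 2 → Fin 2 → Set
  Matched y x = left (transpose XS) y ≈ₘ (left (IS ⊗ₛ IS) ♯) (left XS x)
              × right (transpose XS) y ≈ₘ right XS x
  matched : ∀ y → Matched y (flip₂ y)
  matched zero       = (λ { zero → refl ; (suc zero) → refl }) , (λ { zero → refl ; (suc zero) → refl })
  matched (suc zero) = (λ { zero → refl ; (suc zero) → refl }) , (λ { zero → refl ; (suc zero) → refl })
  unflip : ∀ x → ∃[ y ] Matched y x
  unflip zero       = suc zero , matched (suc zero)
  unflip (suc zero) = zero , matched zero

X-Fn : RealisableFn {2} {2} flip₂
X-Fn = asFn (realised ((`I ⊗ `I) ⨾ `X) X-transposed (λ _ _ → refl) (λ _ _ → refl))

-- Every function between finite sets is realisable: built from the empty map,
-- identities, and the maps copyAt p duplicating coordinate p.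

empty-R : ∀ k {a : Fin 0 → Mset k} → Realisable a
empty-R zero    = congR (⊤-R ⨾R ↓-R) (λ ())
empty-R (suc k) = congR (↓-R ⊗R empty-R k {λ ()}) (λ ())

id-Fn : ∀ k → RealisableFn {k} (λ y → y)
id-Fn zero    = asFn (empty-R 0)
id-Fn (suc k) = congFn (I-Fn ⊗Fn id-Fn k) (⊕f-id 1)

copyAt : ∀ {k} → Fin k → Fin (suc k) → Fin k
copyAt p zero    = p
copyAt p (suc i) = i

-- copyAt (suc p) = (id ⊕f copyAt p) ∘ (flip₂ ⊕f id): swap the first two
-- coordinates, then copy p among the last ones.
copy-Fn : ∀ k (p : Fin k) → RealisableFn (copyAt p)
copy-Fn (suc k) zero =
  congFn (Λ-Fn ⊗Fn id-Fn k) λ { zero → refl ; (suc zero) → refl ; (suc (suc i)) → refl }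
copy-Fn (suc k) (suc p) =
  congFn ((I-Fn ⊗Fn copy-Fn k p) ⨾F (X-Fn ⊗Fn id-Fn k))
         λ { zero → refl ; (suc zero) → refl ; (suc (suc i)) → refl }

fn-R : ∀ k m (π : Fin m → Fin k) → RealisableFn π
fn-R k zero    π = asFn (empty-R k)
fn-R k (suc m) π =
  congFn (copy-Fn k (π zero) ⨾F (id-Fn 1 ⊗Fn fn-R k m (λ y → π (suc y)))) λ { zero → refl ; (suc y) → refl }

-- Every multiset u on k, seen as a map from the one-point carrier, is
-- realisable: first the multiples c · ⟦ 0 ⟧ₘ on k = 1, obtained by adding the
-- point to itself c times with Λ and ∇, then coordinate by coordinate.

const-R : ∀ c → Realisable {1} {1} (λ _ _ → c)
const-R zero    = congR (↓-R ⨾R ⊤-R) (λ _ _ → refl)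
const-R (suc c) =
  congR ((graph Λ-Fn ⨾R (graph I-Fn ⊗R const-R c)) ⨾R ∇-R) λ { zero zero → cong suc c·1+0+0+0≡c }
  where
  c·1+0+0+0≡c : c * 1 + 0 + 0 + 0 ≡ c
  c·1+0+0+0≡c = trans (+-identityʳ _) (trans (+-identityʳ _) (trans (+-identityʳ _) (*-identityʳ c)))

single-R : ∀ k (u : Mset k) → Realisable {k} {1} (λ _ → u)
single-R zero    u = congR ⊤-R (λ _ ())
single-R (suc k) u = congR ((const-R (u zero) ⊗R single-R k (λ j → u (suc j))) ⨾R ∇-R)
  λ { zero zero    → trans (+-identityʳ _) (+-identityʳ _)
      ; zero (suc j) → trans (+-identityʳ _) (+-identityʳ _) }

-- Finally every map a : Fin n → Mset k is realisable: the values a y sit in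
-- disjoint blocks of k + k and are summed back into k by fold.

fold : ∀ k → Fin (k + k) → Fin k
fold k y = [ (λ i → i) , (λ i → i) ] (splitAt k y)

fold-sum : ∀ k (U V : Mset k) → ((λ i → ⟦ fold k i ⟧ₘ) ♯) (U ⊕ₘ V) ≈ₘ (λ j → U j + V j)
fold-sum k U V j = begin
  ∑ (λ i → (U ⊕ₘ V) i * ⟦ fold k i ⟧ₘ j)
    ≡⟨ ∑-split k _ ⟩
  ∑ (λ i → (U ⊕ₘ V) (i ↑ˡ k) * ⟦ fold k (i ↑ˡ k) ⟧ₘ j) + ∑ (λ i → (U ⊕ₘ V) (k ↑ʳ i) * ⟦ fold k (k ↑ʳ i) ⟧ₘ j)
    ≡⟨ cong₂ _+_ (∑-cong (λ i → cong summand (splitAt-↑ˡ k i k))) (∑-cong (λ i → cong summand (splitAt-↑ʳ k k i))) ⟩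
  ∑ (λ i → U i * ⟦ i ⟧ₘ j) + ∑ (λ i → V i * ⟦ i ⟧ₘ j)
    ≡⟨ cong₂ _+_ (♯-unit U j) (♯-unit V j) ⟩
  U j + V j ∎
  where
  open ≡-Reasoning
  summand : Fin k ⊎ Fin k → ℕ
  summand s = [ U , V ] s * ⟦ [ (λ i → i) , (λ i → i) ] s ⟧ₘ j

all-R : ∀ k n (a : Fin n → Mset k) → Realisable a
all-R k zero    a = empty-R k
all-R k (suc n) a =
  congR (graph (fn-R k (k + k) (fold k)) ⨾R (single-R k (a zero) ⊗R all-R k n (λ y → a (suc y)))) blocks
  where
  blocks : ∀ y → ((λ i → ⟦ fold k i ⟧ₘ) ♯) (tens (λ _ → a zero) (λ y → a (suc y)) y) ≈ₘ a y
  blocks zero    j = trans (fold-sum k (a zero) ∅ₘ j) (+-identityʳ _)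
  blocks (suc y) j = fold-sum k ∅ₘ (a (suc y)) j

-- Reading an expression backwards (swapping Δ/∇, ⊥/⊤, Λ/V,
-- ↓/↑) yields an expression denoting the transposed span, because
-- synchronisations, their minimality and hence composites are symmetric.

transposeE : ∀ {k l} → Expr k l → Expr l k
transposeE `Δ = `∇
transposeE `Λ = `V
transposeE `⊥ = `⊤
transposeE `↓ = `↑
transposeE `∇ = `Δ
transposeE `V = `Λ
transposeE `⊤ = `⊥
transposeE `↑ = `↓
transposeE `I = `I
transposeE `X = (`I ⊗ `I) ⨾ `X
transposeE (e₁ ⨾ e₂) = transposeE e₂ ⨾ transposeE e₁
transposeE (e₁ ⊗ e₂) = transposeE e₁ ⊗ transposeE e₂

transpose-minimal : ∀ {a b x} {f : Fin a → Mset x} {g : Fin b → Mset x} {U V} →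
  IsMinimalSync f g U V → IsMinimalSync g f V U
transpose-minimal (sync , nonzero , minimal) =
  ≈ₘ-sym sync , (λ (V≈∅ , U≈∅) → nonzero (U≈∅ , V≈∅)) ,
  (λ V' U' sync' V'≤V U'≤U → swap (minimal U' V' (≈ₘ-sym sync') U'≤U V'≤V))
  where
  swap : ∀ {A B C D : Set} → (A × B) ⊎ (C × D) → (B × A) ⊎ (D × C)
  swap (inj₁ (p , q)) = inj₁ (q , p)
  swap (inj₂ (p , q)) = inj₂ (q , p)

transpose-composite : ∀ {k₀ k₁ k₂} {s₀ : Span k₀ k₁} {s₁ : Span k₁ k₂} {c : Span k₀ k₂} →
  IsComposite s₀ s₁ c → IsComposite (transpose s₁) (transpose s₀) (transpose c)
transpose-composite (inj , covered , attained) =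
  (λ y y' r≈ l≈ → inj y y' l≈ r≈) ,
  (λ y → let (U , V , min , l≈ , r≈) = covered y in V , U , transpose-minimal min , r≈ , l≈) ,
  (λ V U min → let (y , l≈ , r≈) = attained U V (transpose-minimal min) in y , r≈ , l≈)

transpose⇓ : ∀ {k l} {e : Expr k l} {t : Span k l} → e ⇓ t → transposeE e ⇓ transpose t
transpose⇓ ⇓Δ = ⇓∇
transpose⇓ ⇓⊥ = ⇓⊤
transpose⇓ ⇓∇ = ⇓Δ
transpose⇓ ⇓⊤ = ⇓⊥
transpose⇓ ⇓Λ = ⇓V
transpose⇓ ⇓↓ = ⇓↑
transpose⇓ ⇓V = ⇓Λ
transpose⇓ ⇓↑ = ⇓↓
transpose⇓ ⇓I = ⇓I
transpose⇓ ⇓X = X-transposed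
transpose⇓ (⇓⨾ d₁ d₂ composite) = ⇓⨾ (transpose⇓ d₂) (transpose⇓ d₁) (transpose-composite composite)
transpose⇓ (⇓⊗ d₁ d₂) = ⇓⊗ (transpose⇓ d₁) (transpose⇓ d₂)

≅-refl : ∀ {k l} (s : Span k l) → s ≅ s
≅-refl s = record { to = λ y → y ; from = λ y → y ; from-to = λ _ → refl ; to-from = λ _ → refl
                  ; left-to = λ _ _ → refl ; right-to = λ _ _ → refl }

theorem3 : ∀ (k l : ℕ) (s : Span k l) → InjectiveSpan s →
    ∃[ e ] ∃[ t ] (e ⇓ t × t ≅ s)
theorem3 k l (span n a b) inj =
  expr A ⨾ transposeE (expr B) , span n a b ,
  ⇓⨾ (denotes A) (transpose⇓ (denotes B)) composite , ≅-refl (span n a b)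
  where
  A : Realisable a
  A = all-R k n a
  B : Realisable b
  B = all-R l n b
  -- a y ≈ (lft A) ♯ ⟦ y ⟧ₘ ≈ (lft A) ♯ (rgt B y)
  a≈ : ∀ y → a y ≈ₘ (lft A ♯) (rgt B y)
  a≈ y = ≈ₘ-sym (≈ₘ-trans (♯-congʳ (lft A) (rgt≈ B y)) (≈ₘ-trans (♯-δ (lft A) y) (lft≈ A y)))
  composite : IsComposite (span n (lft A) (rgt A)) (transpose (span n (lft B) (rgt B))) (span n a b)
  composite = composite-after-graph′ (rgt≈ A) (span n (rgt B) (lft B)) inj a≈ (λ y → ≈ₘ-sym (lft≈ B y))
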